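{- Let $n\ge1$ and let $T$ be a semistandard Young tableau of type $A_n$ with shape $\lambda$. Then $$\varphi_T(t)=\prod_{u}\bigl(1-t^{|h(u)|}\bigr),$$ where the product runs over all boxes $u$ of $T$ for which there is no box $v\in h(u)$ with $c(v)=c(u)$.
   Context: The alphabet is $\{1<\dots<n+1\}$. A Young tableau of type $A_n$ of shape $\lambda$ is the left-aligned diagram of a partition $\lambda=(\lambda_1\ge\dots\ge\lambda_k>0)$ with $k\le n$ rows, filled with letters strictly increasing down columns. It is semistandard if entries weakly increase along rows. Write $c(u)$ for the entry of a box $u$. For a partition $\nu$ let $\nu'_j$ be the number of boxes in the $j$-th column of its diagram, with columns numbered $1,2,\dots$ from the left, and let $m_j(\nu)=\nu'_j-\nu'_{j+1}$. For $a=0,\dots,n+1$ let $\lambda^{(a)}$ be the shape formed by the boxes of $T$ with entries $\le a$, so $\lambda^{(0)}\subset\dots\subset\lambda^{(n+1)}=\lambda$. For partitions $\nu\supset\kappa$ let $\theta'_j=\nu'_j-\kappa'_j$, let $I=\{j\ge1:\theta'_j>\theta'_{j+1}\}$, and set $$\varphi_{\nu/\kappa}(t)=\prod_{j\in I}\bigl(1-t^{m_j(\nu)}\bigr).$$ Define $$\varphi_T(t)=\prod_{a=1}^{n+1}\varphi_{\lambda^{(a)}/\lambda^{(a-1)}}(t).$$ The augmented tableau $\hat T$ is obtained from $T$ by appending one box filled with $\infty$ at the right end of each row, where $a<\infty$ for all letters $a$. For a box $u$ of $T$ in row $j$ and some column, its head $h(u)$ is the set of boxes $v$ of $\hat T$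 in the next column to the right, in rows $\le j$, with $c(u)\le c(v)$. -}

module Defs where

open import Data.Nat using (ℕ; zero; suc; _+_; _∸_; _≤_; _<_; _≤ᵇ_; _<ᵇ_; _≡ᵇ_)
open import Data.Integer as ℤ using (ℤ; +_; -_)
open import Data.List using (List; []; _∷_; length)
open import Data.Maybe using (Maybe; just; nothing)
open import Data.Bool using (Bool; true; false; if_then_else_; _∧_; _∨_; not)
open import Data.Product using (_×_)
open import Relation.Binary.PropositionalEquality using (_≡_)

-- Polynomials in t with integer coefficients: coefficient lists,
-- lowest degree first.  Equality = equality of all coefficients.

Poly : Set
Poly = List ℤ

coeff : Poly → ℕ → ℤ
coeff []       _       = + 0
coeff (c ∷ _)  zero    = c
coeff (_ ∷ cs) (suc k) = coeff cs k

_+ᴾ_ : Poly → Poly → Poly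
[]       +ᴾ q        = q
(a ∷ p)  +ᴾ []       = a ∷ p
(a ∷ p)  +ᴾ (b ∷ q)  = (a ℤ.+ b) ∷ (p +ᴾ q)

scale : ℤ → Poly → Poly
scale c []       = []
scale c (a ∷ p)  = (c ℤ.* a) ∷ scale c p

_*ᴾ_ : Poly → Poly → Poly
[]      *ᴾ q = []
(a ∷ p) *ᴾ q = scale a q +ᴾ (+ 0 ∷ (p *ᴾ q))

oneᴾ : Poly
oneᴾ = + 1 ∷ []

monomial : ℕ → Poly
monomial zero    = + 1 ∷ []
monomial (suc m) = + 0 ∷ monomial m

oneMinusT^ : ℕ → Poly
oneMinusT^ m = oneᴾ +ᴾ scale (- (+ 1)) (monomial m)

infix 4 _≈ᴾ_
_≈ᴾ_ : Poly → Poly → Set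
p ≈ᴾ q = ∀ k → coeff p k ≡ coeff q k

prodBelow : ℕ → (ℕ → Poly) → Poly
prodBelow zero    f = oneᴾ
prodBelow (suc N) f = prodBelow N f *ᴾ f N

countBelow : ℕ → (ℕ → Bool) → ℕ
countBelow zero    b = 0
countBelow (suc N) b = countBelow N b + (if b N then 1 else 0)

-- Tableaux: a list of rows (top row first), each row a list of letters
-- (left to right).  Rows and columns are indexed from 0 internally.

Tableau : Set
Tableau = List (List ℕ)

nth : {A : Set} → List A → ℕ → Maybe A
nth []       _       = nothing
nth (x ∷ _)  zero    = just x
nth (_ ∷ xs) (suc k) = nth xs k

rowLen : Tableau → ℕ → ℕ
rowLen T i with nth T i
... | just r  = length r
... | nothing = 0

entry : Tableau → ℕ → ℕ → Maybe ℕ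
entry T i j with nth T i
... | just r  = nth r j
... | nothing = nothing

record SSYT (n : ℕ) (T : Tableau) : Set where
  field
    rows≤n     : length T ≤ n
    rowsNonempty : ∀ i → i < length T → 1 ≤ rowLen T i
    partition  : ∀ i → rowLen T (suc i) ≤ rowLen T i
    alphabet   : ∀ i j a → entry T i j ≡ just a → (1 ≤ a) × (a ≤ suc n)
    rowWeak    : ∀ i j a b → entry T i j ≡ just a → entry T i (suc j) ≡ just b → a ≤ b
    colStrict  : ∀ i j a b → entry T i j ≡ just a → entry T (suc i) j ≡ just b → a < b

-- is the box (i, j) in λ^(a), i.e. present with entry ≤ a ?
inSub : Tableau → ℕ → ℕ → ℕ → Bool
inSub T a i j with entry T i j
... | just x  = x ≤ᵇ a
... | nothing = false

-- (λ^(a))'_{k+1} : length of the column numbered k+1 (0-indexed column k)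
colLen : Tableau → ℕ → ℕ → ℕ
colLen T a k = countBelow (length T) (λ i → inSub T a i k)

-- φ_{λ^(a)/λ^(a-1)}(t) for a ≥ 1 (given as a = suc b).  Column number
-- j = k+1; columns beyond the first row (k ≥ rowLen T 0) have θ'_j = 0,
-- hence never lie in I.
phiSkew : Tableau → ℕ → Poly
phiSkew T b = prodBelow (rowLen T 0) factor
  where
    a = suc b
    θ' : ℕ → ℕ
    θ' k = colLen T a k ∸ colLen T b k
    m : ℕ → ℕ
    m k = colLen T a k ∸ colLen T a (suc k)
    factor : ℕ → Poly
    factor k = if θ' (suc k) <ᵇ θ' k then oneMinusT^ (m k) else oneᴾ

phiT : ℕ → Tableau → Poly
phiT n T = prodBelow (suc n) (phiSkew T)

data Aug : Set where
  fin : ℕ → Aug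
  ∞   : Aug

-- c(v) for the box (r, j) of the augmented tableau \hat T, if it exists:
-- the ∞ box sits at column rowLen T r of each row r of T.
augEntry : Tableau → ℕ → ℕ → Maybe Aug
augEntry T r j with nth T r
... | nothing = nothing
... | just row with nth row j
...   | just x  = just (fin x)
...   | nothing = if j ≡ᵇ length row then just ∞ else nothing

_≤ᴬᵇ_ : ℕ → Aug → Bool
x ≤ᴬᵇ fin y = x ≤ᵇ y
x ≤ᴬᵇ ∞     = true

_≡ᴬᵇ_ : ℕ → Aug → Bool
x ≡ᴬᵇ fin y = x ≡ᵇ y
x ≡ᴬᵇ ∞     = false

-- is the box v = (r, j+1) of \hat T in h(u) for u = (i, j) with c(u) = x ?
-- (requires r ≤ i, which is enforced by counting r < i+1)
inHead : Tableau → ℕ → ℕ → ℕ → Bool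
inHead T x j r with augEntry T r (suc j)
... | just v  = x ≤ᴬᵇ v
... | nothing = false

sameInHead : Tableau → ℕ → ℕ → ℕ → Bool
sameInHead T x j r with augEntry T r (suc j)
... | just v  = (x ≤ᴬᵇ v) ∧ (x ≡ᴬᵇ v)
... | nothing = false

headSize : Tableau → ℕ → ℕ → ℕ
headSize T i j with entry T i j
... | just x  = countBelow (suc i) (inHead T x j)
... | nothing = 0

noEqualInHead : Tableau → ℕ → ℕ → Bool
noEqualInHead T i j with entry T i j
... | just x  = countBelow (suc i) (sameInHead T x j) ≡ᵇ 0
... | nothing = false

headProduct : Tableau → Poly
headProduct T =
  prodBelow (length T) λ i →
    prodBelow (rowLen T i) λ j →
      if noEqualInHead T i j then oneMinusT^ (headSize T i j) else oneᴾ

-- If the letter a = b + 1 occurs in column j, it occurs exactly once there (columns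
-- strictly increase), in the box u of row r = (λ^(b))'_j + 1, and (λ^(a))'_j = r.  Then
-- θ'_j = 1, so j ∈ I iff θ'_{j+1} = 0, and m_j(λ^(a)) = r − (λ^(a))'_{j+1}.  The head h(u)
-- consists of the boxes of column j+1 of T̂ in rows ≤ r whose entry is not ≤ b (the ∞ box
-- included), so |h(u)| = r − (λ^(b))'_{j+1}, and exactly θ'_{j+1} of them carry the letter a.
-- When θ'_{j+1} = 0 the two exponents agree, so the factor of φ_{λ^(a)/λ^(a−1)} at column j
-- is the factor of u, while columns without a contribute 1; regrouping the product over letters and columns into one over boxes gives
-- the theorem.

module Submission where

open import Defs
open import Algebra.Bundles using (CommutativeMonoid)
open import Algebra.Structures.Biased using (isCommutativeMonoidˡ)
import Algebra.Properties.CommutativeSemigroup as CommutativeSemigroupProperties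
open import Data.Bool using (Bool; true; false; if_then_else_; _∧_; not)
open import Data.Bool.Properties using (T-≡)
open import Data.Integer using (+_) renaming (_+_ to _+ℤ_; _*_ to _*ℤ_)
import Data.Integer.Properties as ℤ
open import Data.List using (List; []; _∷_; length)
open import Data.Maybe using (Maybe; just; nothing)
open import Data.Maybe.Properties using (just-injective) renaming (≡-dec to ≡-decₘ)
open import Data.Nat as ℕ
  using (ℕ; zero; suc; _+_; _∸_; _≤_; _<_; _≤′_; ≤′-refl; ≤′-step; _<?_; _<ᵇ_; _≤ᵇ_; _≡ᵇ_; z≤n; s≤s)
open import Data.Nat.Properties
  using (≤-refl; ≤-reflexive; ≤-trans; ≤-antisym; ≤-pred; <-trans; <-≤-trans; ≤-<-trans; <-irrefl; <⇒≤;
         ≮⇒≥; ≰⇒>; <⇒≱; n<1+n; n≤1+n; m≤n⇒m≤1+n; m≤n⇒m<n∨m≡n; ≤⇒≤′; suc-injective;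
         +-comm; +-identityʳ; +-monoˡ-≤; +-mono-≤; +-commutativeSemigroup;
         m+n∸n≡m; m∸n≡0⇒m≤n; m≤n⇒m∸n≡0;
         <ᵇ-reflects-<; ≤ᵇ-reflects-≤; ≤ᵇ⇒≤; ≤⇒≤ᵇ; <ᵇ⇒<; <⇒<ᵇ; ≡ᵇ⇒≡; ≡⇒≡ᵇ)
open import Data.Product using (∃; _×_; _,_; proj₁; proj₂; uncurry)
open import Data.Sum using (inj₁; inj₂)
open import Function using (_∘_)
open import Function.Bundles using (Equivalence)
open import Level using (0ℓ)
open import Relation.Binary.Bundles using (Setoid)
open import Relation.Binary.Definitions using (DecidableEquality)
open import Relation.Binary.Structures using (IsEquivalence)
open import Relation.Binary.PropositionalEquality
  using (_≡_; _≢_; refl; sym; trans; cong; cong₂; subst; module ≡-Reasoning)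
import Relation.Binary.Reasoning.Setoid as SetoidReasoning
open import Relation.Nullary using (¬_; contradiction; yes; no)
open import Relation.Nullary.Reflects using (Reflects; ofʸ; ofⁿ; ¬-reflects; _×-reflects_; fromEquivalence)

-- Polynomial arithmetic

infix 4 _≋_

-- Wrapping _≈ᴾ_ in a record lets Agda infer both polynomials from an equation.
record _≋_ (p q : Poly) : Set where
  constructor coeffwise
  field coeff-≡ : p ≈ᴾ q
open _≋_ public

≋-isEquivalence : IsEquivalence _≋_
≋-isEquivalence = record
  { refl  = coeffwise λ _ → refl
  ; sym   = λ e → coeffwise λ k → sym (coeff-≡ e k)
  ; trans = λ e f → coeffwise λ k → trans (coeff-≡ e k) (coeff-≡ f k)
  }

≋-setoid : Setoid 0ℓ 0ℓ
≋-setoid = record { isEquivalence = ≋-isEquivalence }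

open IsEquivalence ≋-isEquivalence public
  using () renaming (refl to ≋-refl; sym to ≋-sym; trans to ≋-trans; reflexive to ≡⇒≋)

coeff-+ᴾ : ∀ p q k → coeff (p +ᴾ q) k ≡ coeff p k +ℤ coeff q k
coeff-+ᴾ []      q       k       = sym (ℤ.+-identityˡ _)
coeff-+ᴾ (a ∷ p) []      k       = sym (ℤ.+-identityʳ _)
coeff-+ᴾ (a ∷ p) (b ∷ q) zero    = refl
coeff-+ᴾ (a ∷ p) (b ∷ q) (suc k) = coeff-+ᴾ p q k

coeff-scale : ∀ c p k → coeff (scale c p) k ≡ c *ℤ coeff p k
coeff-scale c []      k       = sym (ℤ.*-zeroʳ c)
coeff-scale c (a ∷ p) zero    = refl
coeff-scale c (a ∷ p) (suc k) = coeff-scale c p k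

∷-cong : ∀ {a b p q} → a ≡ b → p ≋ q → (a ∷ p) ≋ (b ∷ q)
∷-cong a≡b p≋q = coeffwise λ { zero → a≡b ; (suc k) → coeff-≡ p≋q k }

0∷[]≋[] : (+ 0 ∷ []) ≋ []
0∷[]≋[] = coeffwise λ { zero → refl ; (suc k) → refl }

+ᴾ-cong : ∀ {p p' q q'} → p ≋ p' → q ≋ q' → (p +ᴾ q) ≋ (p' +ᴾ q')
+ᴾ-cong {p} {p'} {q} {q'} e f = coeffwise λ k → begin
  coeff (p +ᴾ q) k           ≡⟨ coeff-+ᴾ p q k ⟩
  coeff p k +ℤ coeff q k    ≡⟨ cong₂ _+ℤ_ (coeff-≡ e k) (coeff-≡ f k) ⟩
  coeff p' k +ℤ coeff q' k  ≡⟨ coeff-+ᴾ p' q' k ⟨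
  coeff (p' +ᴾ q') k         ∎
  where open ≡-Reasoning

+ᴾ-assoc : ∀ p q r → ((p +ᴾ q) +ᴾ r) ≋ (p +ᴾ (q +ᴾ r))
+ᴾ-assoc p q r = coeffwise λ k → begin
  coeff ((p +ᴾ q) +ᴾ r) k                   ≡⟨ coeff-+ᴾ (p +ᴾ q) r k ⟩
  coeff (p +ᴾ q) k +ℤ coeff r k            ≡⟨ cong (_+ℤ coeff r k) (coeff-+ᴾ p q k) ⟩
  (coeff p k +ℤ coeff q k) +ℤ coeff r k   ≡⟨ ℤ.+-assoc (coeff p k) _ _ ⟩
  coeff p k +ℤ (coeff q k +ℤ coeff r k)   ≡⟨ cong (coeff p k +ℤ_) (coeff-+ᴾ q r k) ⟨
  coeff p k +ℤ coeff (q +ᴾ r) k            ≡⟨ coeff-+ᴾ p (q +ᴾ r) k ⟨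
  coeff (p +ᴾ (q +ᴾ r)) k                   ∎
  where open ≡-Reasoning

+ᴾ-comm : ∀ p q → (p +ᴾ q) ≋ (q +ᴾ p)
+ᴾ-comm p q = coeffwise λ k → begin
  coeff (p +ᴾ q) k          ≡⟨ coeff-+ᴾ p q k ⟩
  coeff p k +ℤ coeff q k   ≡⟨ ℤ.+-comm (coeff p k) _ ⟩
  coeff q k +ℤ coeff p k   ≡⟨ coeff-+ᴾ q p k ⟨
  coeff (q +ᴾ p) k          ∎
  where open ≡-Reasoning

+ᴾ-commutativeMonoid : CommutativeMonoid 0ℓ 0ℓ
+ᴾ-commutativeMonoid = record
  { _∙_                 = _+ᴾ_
  ; ε                   = []
  ; isCommutativeMonoid = isCommutativeMonoidˡ record
    { isSemigroup = record
      { isMagma = record { isEquivalence = ≋-isEquivalence ; ∙-cong = +ᴾ-cong }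
      ; assoc   = +ᴾ-assoc
      }
    ; identityˡ = λ _ → ≋-refl
    ; comm      = +ᴾ-comm
    }
  }

open CommutativeSemigroupProperties (CommutativeMonoid.commutativeSemigroup +ᴾ-commutativeMonoid)
  using () renaming (interchange to +ᴾ-interchange; x∙yz≈y∙xz to +ᴾ-x∙yz≈y∙xz)

+ᴾ-identityʳ : ∀ p → (p +ᴾ []) ≋ p
+ᴾ-identityʳ = CommutativeMonoid.identityʳ +ᴾ-commutativeMonoid

scale-zero : ∀ p → scale (+ 0) p ≋ []
scale-zero p = coeffwise (coeff-scale (+ 0) p)

scale-one : ∀ p → scale (+ 1) p ≋ p
scale-one p = coeffwise λ k → trans (coeff-scale (+ 1) p k) (ℤ.*-identityˡ _)

scale-+ℤ : ∀ a b p → scale (a +ℤ b) p ≋ (scale a p +ᴾ scale b p)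
scale-+ℤ a b p = coeffwise λ k → begin
  coeff (scale (a +ℤ b) p) k                ≡⟨ coeff-scale (a +ℤ b) p k ⟩
  (a +ℤ b) *ℤ coeff p k                     ≡⟨ ℤ.*-distribʳ-+ (coeff p k) a b ⟩
  a *ℤ coeff p k +ℤ b *ℤ coeff p k          ≡⟨ cong₂ _+ℤ_ (coeff-scale a p k) (coeff-scale b p k) ⟨
  coeff (scale a p) k +ℤ coeff (scale b p) k ≡⟨ coeff-+ᴾ (scale a p) (scale b p) k ⟨
  coeff (scale a p +ᴾ scale b p) k          ∎
  where open ≡-Reasoning

scale-+ᴾ : ∀ c p q → scale c (p +ᴾ q) ≋ (scale c p +ᴾ scale c q)
scale-+ᴾ c p q = coeffwise λ k → begin
  coeff (scale c (p +ᴾ q)) k                  ≡⟨ coeff-scale c (p +ᴾ q) k ⟩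
  c *ℤ coeff (p +ᴾ q) k                       ≡⟨ cong (c *ℤ_) (coeff-+ᴾ p q k) ⟩
  c *ℤ (coeff p k +ℤ coeff q k)               ≡⟨ ℤ.*-distribˡ-+ c _ _ ⟩
  c *ℤ coeff p k +ℤ c *ℤ coeff q k            ≡⟨ cong₂ _+ℤ_ (coeff-scale c p k) (coeff-scale c q k) ⟨
  coeff (scale c p) k +ℤ coeff (scale c q) k  ≡⟨ coeff-+ᴾ (scale c p) (scale c q) k ⟨
  coeff (scale c p +ᴾ scale c q) k            ∎
  where open ≡-Reasoning

scale-scale : ∀ c d p → scale c (scale d p) ≋ scale (c *ℤ d) p
scale-scale c d p = coeffwise λ k → begin
  coeff (scale c (scale d p)) k  ≡⟨ coeff-scale c (scale d p) k ⟩
  c *ℤ coeff (scale d p) k       ≡⟨ cong (c *ℤ_) (coeff-scale d p k) ⟩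
  c *ℤ (d *ℤ coeff p k)          ≡⟨ ℤ.*-assoc c d _ ⟨
  (c *ℤ d) *ℤ coeff p k          ≡⟨ coeff-scale (c *ℤ d) p k ⟨
  coeff (scale (c *ℤ d) p) k     ∎
  where open ≡-Reasoning

*ᴾ-zeroˡ : ∀ {p} q → p ≋ [] → (p *ᴾ q) ≋ []
*ᴾ-zeroˡ {[]}    q _ = ≋-refl
*ᴾ-zeroˡ {a ∷ p} q e = begin
  scale a q +ᴾ (+ 0 ∷ (p *ᴾ q))
    ≈⟨ +ᴾ-cong scale-a≋[] (∷-cong refl (*ᴾ-zeroˡ {p} q (coeffwise (coeff-≡ e ∘ suc)))) ⟩
  [] +ᴾ (+ 0 ∷ [])
    ≈⟨ 0∷[]≋[] ⟩
  []
    ∎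
  where
  open SetoidReasoning ≋-setoid
  scale-a≋[] : scale a q ≋ []
  scale-a≋[] = subst (λ c → scale c q ≋ []) (sym (coeff-≡ e zero)) (scale-zero q)

*ᴾ-congʳ : ∀ {p p'} q → p ≋ p' → (p *ᴾ q) ≋ (p' *ᴾ q)
*ᴾ-congʳ {[]}    {p'}      q e = ≋-sym (*ᴾ-zeroˡ q (≋-sym e))
*ᴾ-congʳ {a ∷ p} {[]}      q e = *ᴾ-zeroˡ q e
*ᴾ-congʳ {a ∷ p} {a' ∷ p'} q e =
  +ᴾ-cong (≡⇒≋ (cong (λ c → scale c q) (coeff-≡ e zero)))
          (∷-cong refl (*ᴾ-congʳ {p} {p'} q (coeffwise (coeff-≡ e ∘ suc))))

*ᴾ-zeroʳ : ∀ p → (p *ᴾ []) ≋ []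
*ᴾ-zeroʳ []      = ≋-refl
*ᴾ-zeroʳ (a ∷ p) = ≋-trans (∷-cong refl (*ᴾ-zeroʳ p)) 0∷[]≋[]

*ᴾ-∷ʳ : ∀ p b q → (p *ᴾ (b ∷ q)) ≋ (scale b p +ᴾ (+ 0 ∷ (p *ᴾ q)))
*ᴾ-∷ʳ []      b q = ≋-sym 0∷[]≋[]
*ᴾ-∷ʳ (a ∷ p) b q = ∷-cong (cong (_+ℤ + 0) (ℤ.*-comm a b)) (begin
  scale a q +ᴾ (p *ᴾ (b ∷ q))                      ≈⟨ +ᴾ-cong (≋-refl {scale a q}) (*ᴾ-∷ʳ p b q) ⟩
  scale a q +ᴾ (scale b p +ᴾ (+ 0 ∷ (p *ᴾ q)))     ≈⟨ +ᴾ-x∙yz≈y∙xz (scale a q) (scale b p) _ ⟩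
  scale b p +ᴾ (scale a q +ᴾ (+ 0 ∷ (p *ᴾ q)))     ∎)
  where open SetoidReasoning ≋-setoid

*ᴾ-comm : ∀ p q → (p *ᴾ q) ≋ (q *ᴾ p)
*ᴾ-comm []      q = ≋-sym (*ᴾ-zeroʳ q)
*ᴾ-comm (a ∷ p) q = ≋-trans (+ᴾ-cong (≋-refl {scale a q}) (∷-cong refl (*ᴾ-comm p q))) (≋-sym (*ᴾ-∷ʳ q a p))

*ᴾ-cong : ∀ {p p' q q'} → p ≋ p' → q ≋ q' → (p *ᴾ q) ≋ (p' *ᴾ q')
*ᴾ-cong {p} {p'} {q} {q'} e f = begin
  p *ᴾ q    ≈⟨ *ᴾ-congʳ q e ⟩
  p' *ᴾ q   ≈⟨ *ᴾ-comm p' q ⟩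
  q *ᴾ p'   ≈⟨ *ᴾ-congʳ p' f ⟩
  q' *ᴾ p'  ≈⟨ *ᴾ-comm q' p' ⟩
  p' *ᴾ q'  ∎
  where open SetoidReasoning ≋-setoid

*ᴾ-distribʳ : ∀ p q r → ((p +ᴾ q) *ᴾ r) ≋ ((p *ᴾ r) +ᴾ (q *ᴾ r))
*ᴾ-distribʳ []      q       r = ≋-refl
*ᴾ-distribʳ (a ∷ p) []      r = ≋-sym (+ᴾ-identityʳ _)
*ᴾ-distribʳ (a ∷ p) (b ∷ q) r = begin
  scale (a +ℤ b) r +ᴾ (+ 0 ∷ ((p +ᴾ q) *ᴾ r))
    ≈⟨ +ᴾ-cong (scale-+ℤ a b r) (∷-cong refl (*ᴾ-distribʳ p q r)) ⟩
  (scale a r +ᴾ scale b r) +ᴾ ((+ 0 ∷ (p *ᴾ r)) +ᴾ (+ 0 ∷ (q *ᴾ r)))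
    ≈⟨ +ᴾ-interchange (scale a r) (scale b r) (+ 0 ∷ (p *ᴾ r)) (+ 0 ∷ (q *ᴾ r)) ⟩
  ((a ∷ p) *ᴾ r) +ᴾ ((b ∷ q) *ᴾ r)
    ∎
  where open SetoidReasoning ≋-setoid

scale-*ᴾ : ∀ c p q → (scale c p *ᴾ q) ≋ scale c (p *ᴾ q)
scale-*ᴾ c []      q = ≋-refl
scale-*ᴾ c (b ∷ p) q = begin
  scale (c *ℤ b) q +ᴾ (+ 0 ∷ (scale c p *ᴾ q))
    ≈⟨ +ᴾ-cong (≋-sym (scale-scale c b q)) (∷-cong (sym (ℤ.*-zeroʳ c)) (scale-*ᴾ c p q)) ⟩
  scale c (scale b q) +ᴾ scale c (+ 0 ∷ (p *ᴾ q))
    ≈⟨ scale-+ᴾ c (scale b q) (+ 0 ∷ (p *ᴾ q)) ⟨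
  scale c ((b ∷ p) *ᴾ q)
    ∎
  where open SetoidReasoning ≋-setoid

*ᴾ-assoc : ∀ p q r → ((p *ᴾ q) *ᴾ r) ≋ (p *ᴾ (q *ᴾ r))
*ᴾ-assoc []      q r = ≋-refl
*ᴾ-assoc (a ∷ p) q r = begin
  (scale a q +ᴾ (+ 0 ∷ (p *ᴾ q))) *ᴾ r
    ≈⟨ *ᴾ-distribʳ (scale a q) (+ 0 ∷ (p *ᴾ q)) r ⟩
  (scale a q *ᴾ r) +ᴾ ((+ 0 ∷ (p *ᴾ q)) *ᴾ r)
    ≈⟨ +ᴾ-cong (scale-*ᴾ a q r) (+ᴾ-cong (scale-zero r) (∷-cong refl (*ᴾ-assoc p q r))) ⟩
  (a ∷ p) *ᴾ (q *ᴾ r)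
    ∎
  where open SetoidReasoning ≋-setoid

*ᴾ-identityˡ : ∀ p → (oneᴾ *ᴾ p) ≋ p
*ᴾ-identityˡ p = ≋-trans (+ᴾ-cong (scale-one p) 0∷[]≋[]) (+ᴾ-identityʳ p)

*ᴾ-commutativeMonoid : CommutativeMonoid 0ℓ 0ℓ
*ᴾ-commutativeMonoid = record
  { _∙_                 = _*ᴾ_
  ; ε                   = oneᴾ
  ; isCommutativeMonoid = isCommutativeMonoidˡ record
    { isSemigroup = record
      { isMagma = record { isEquivalence = ≋-isEquivalence ; ∙-cong = *ᴾ-cong }
      ; assoc   = *ᴾ-assoc
      }
    ; identityˡ = *ᴾ-identityˡ
    ; comm      = *ᴾ-comm
    }
  }

open CommutativeSemigroupProperties (CommutativeMonoid.commutativeSemigroup *ᴾ-commutativeMonoid)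
  using () renaming (interchange to *ᴾ-interchange)

*ᴾ-identityʳ : ∀ p → (p *ᴾ oneᴾ) ≋ p
*ᴾ-identityʳ = CommutativeMonoid.identityʳ *ᴾ-commutativeMonoid

-- Finite products

prodBelow-cong : ∀ N {f g} → (∀ i → i < N → f i ≋ g i) → prodBelow N f ≋ prodBelow N g
prodBelow-cong zero    f≋g = ≋-refl
prodBelow-cong (suc N) f≋g = *ᴾ-cong (prodBelow-cong N λ i i<N → f≋g i (m≤n⇒m≤1+n i<N)) (f≋g N ≤-refl)

prodBelow-oneᴾ : ∀ N {f} → (∀ i → i < N → f i ≋ oneᴾ) → prodBelow N f ≋ oneᴾ
prodBelow-oneᴾ zero    f≋1 = ≋-refl
prodBelow-oneᴾ (suc N) f≋1 =
  ≋-trans (*ᴾ-cong (prodBelow-oneᴾ N λ i i<N → f≋1 i (m≤n⇒m≤1+n i<N)) (f≋1 N ≤-refl)) (*ᴾ-identityˡ oneᴾ)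

prodBelow-*ᴾ : ∀ N f g → prodBelow N (λ i → f i *ᴾ g i) ≋ (prodBelow N f *ᴾ prodBelow N g)
prodBelow-*ᴾ zero    f g = ≋-sym (*ᴾ-identityˡ oneᴾ)
prodBelow-*ᴾ (suc N) f g = ≋-trans (*ᴾ-cong (prodBelow-*ᴾ N f g) ≋-refl)
                                   (*ᴾ-interchange (prodBelow N f) (prodBelow N g) (f N) (g N))

prodBelow-swap : ∀ N M (h : ℕ → ℕ → Poly) →
  prodBelow N (λ i → prodBelow M (h i)) ≋ prodBelow M (λ j → prodBelow N (λ i → h i j))
prodBelow-swap zero    M h = ≋-sym (prodBelow-oneᴾ M λ _ _ → ≋-refl)
prodBelow-swap (suc N) M h = ≋-trans (*ᴾ-cong (prodBelow-swap N M h) ≋-refl)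
                                     (≋-sym (prodBelow-*ᴾ M (λ j → prodBelow N (λ i → h i j)) (h N)))

prodBelow-reverse₃ : ∀ A B C (h : ℕ → ℕ → ℕ → Poly) →
  prodBelow A (λ a → prodBelow B (λ b → prodBelow C (h a b)))
    ≋ prodBelow C (λ c → prodBelow B (λ b → prodBelow A (λ a → h a b c)))
prodBelow-reverse₃ A B C h = begin
  prodBelow A (λ a → prodBelow B (λ b → prodBelow C (h a b)))
    ≈⟨ prodBelow-swap A B _ ⟩
  prodBelow B (λ b → prodBelow A (λ a → prodBelow C (h a b)))
    ≈⟨ prodBelow-cong B (λ b _ → prodBelow-swap A C _) ⟩
  prodBelow B (λ b → prodBelow C (λ c → prodBelow A (λ a → h a b c)))
    ≈⟨ prodBelow-swap B C _ ⟩
  prodBelow C (λ c → prodBelow B (λ b → prodBelow A (λ a → h a b c)))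
    ∎
  where open SetoidReasoning ≋-setoid

prodBelow-single : ∀ N {f} i₀ → i₀ < N → (∀ i → i < N → i ≢ i₀ → f i ≋ oneᴾ) → prodBelow N f ≋ f i₀
prodBelow-single (suc N) {f} i₀ i₀<1+N f≋1 with m≤n⇒m<n∨m≡n (≤-pred i₀<1+N)
... | inj₂ refl = ≋-trans (*ᴾ-cong (prodBelow-oneᴾ N λ i i<N →
                                     f≋1 i (m≤n⇒m≤1+n i<N) λ { refl → <-irrefl refl i<N })
                                   ≋-refl)
                          (*ᴾ-identityˡ (f N))
... | inj₁ i₀<N = ≋-trans (*ᴾ-cong (prodBelow-single N i₀ i₀<N λ i i<N → f≋1 i (m≤n⇒m≤1+n i<N))
                                   (f≋1 N ≤-refl λ { refl → <-irrefl refl i₀<N }))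
                          (*ᴾ-identityʳ (f i₀))

prodBelow-truncate : ∀ {M} N {f} → M ≤ N → (∀ i → M ≤ i → i < N → f i ≋ oneᴾ) → prodBelow N f ≋ prodBelow M f
prodBelow-truncate zero    z≤n    f≋1 = ≋-refl
prodBelow-truncate (suc N) M≤1+N f≋1 with m≤n⇒m<n∨m≡n M≤1+N
... | inj₂ refl = ≋-refl
... | inj₁ M<1+N = ≋-trans (*ᴾ-cong (prodBelow-truncate N M≤N λ i M≤i i<N → f≋1 i M≤i (m≤n⇒m≤1+n i<N))
                                    (f≋1 N M≤N ≤-refl))
                           (*ᴾ-identityʳ _)
  where M≤N = ≤-pred M<1+N

true⇔<⇒≡<ᵇ : ∀ {b i d} → (i < d → b ≡ true) → (b ≡ true → i < d) → b ≡ (i <ᵇ d)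
true⇔<⇒≡<ᵇ {b} {i} {d} <⇒b b⇒< with i <ᵇ d | <ᵇ-reflects-< i d | b
... | true  | ofʸ i<d | _     = <⇒b i<d
... | false | ofⁿ _   | false = refl
... | false | ofⁿ i≮d | true  = contradiction (b⇒< refl) i≮d

<⇒<ᵇ≡true : ∀ {i d} → i < d → (i <ᵇ d) ≡ true
<⇒<ᵇ≡true i<d = Equivalence.to T-≡ (<⇒<ᵇ i<d)

≥⇒<ᵇ≡false : ∀ {i d} → d ≤ i → (i <ᵇ d) ≡ false
≥⇒<ᵇ≡false {i} d≤i = sym (true⇔<⇒≡<ᵇ (λ i<d → contradiction (<-≤-trans i<d d≤i) (<-irrefl refl)) λ ())

≤ᵇ≡true⇒≤ : ∀ {m n} → (m ≤ᵇ n) ≡ true → m ≤ n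
≤ᵇ≡true⇒≤ {m} {n} e = ≤ᵇ⇒≤ m n (Equivalence.from T-≡ e)

≤⇒≤ᵇ≡true : ∀ {m n} → m ≤ n → (m ≤ᵇ n) ≡ true
≤⇒≤ᵇ≡true m≤n = Equivalence.to T-≡ (≤⇒≤ᵇ m≤n)

<ᵇ≡true⇒< : ∀ {m n} → (m <ᵇ n) ≡ true → m < n
<ᵇ≡true⇒< {m} {n} e = <ᵇ⇒< m n (Equivalence.from T-≡ e)

reflects-⇔⇒≡ : ∀ {A B : Set} {a b} → Reflects A a → Reflects B b → (A → B) → (B → A) → a ≡ b
reflects-⇔⇒≡ (ofʸ _) (ofʸ _) _   _   = refl
reflects-⇔⇒≡ (ofⁿ _) (ofⁿ _) _   _   = refl
reflects-⇔⇒≡ (ofʸ x) (ofⁿ ¬y) A⇒B _  = contradiction (A⇒B x) ¬y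
reflects-⇔⇒≡ (ofⁿ ¬x) (ofʸ y) _ B⇒A  = contradiction (B⇒A y) ¬x

1+b≤ᵇ≡not≤ᵇ : ∀ b y → (suc b ≤ᵇ y) ≡ not (y ≤ᵇ b)
1+b≤ᵇ≡not≤ᵇ b y = reflects-⇔⇒≡ (≤ᵇ-reflects-≤ (suc b) y) (¬-reflects (≤ᵇ-reflects-≤ y b)) <⇒≱ ≰⇒>

≡ᵇ-reflects-≡ : ∀ m n → Reflects (m ≡ n) (m ≡ᵇ n)
≡ᵇ-reflects-≡ m n = fromEquivalence (≡ᵇ⇒≡ m n) (≡⇒≡ᵇ m n)

-- Both sides test y ≡ suc b.
1+b≤ᵇ∧≡ᵇ≡≤ᵇ∧not≤ᵇ : ∀ b y → ((suc b ≤ᵇ y) ∧ (suc b ≡ᵇ y)) ≡ ((y ≤ᵇ suc b) ∧ not (y ≤ᵇ b))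
1+b≤ᵇ∧≡ᵇ≡≤ᵇ∧not≤ᵇ b y = reflects-⇔⇒≡ (≤ᵇ-reflects-≤ (suc b) y ×-reflects ≡ᵇ-reflects-≡ (suc b) y)
                          (≤ᵇ-reflects-≤ y (suc b) ×-reflects ¬-reflects (≤ᵇ-reflects-≤ y b))
                          (λ { (_ , refl) → ≤-refl , <⇒≱ ≤-refl })
                          (λ { (y≤1+b , y≰b) → let y≡1+b = ≤-antisym y≤1+b (≰⇒> y≰b) in
                                 ≤-reflexive (sym y≡1+b) , sym y≡1+b })

-- Counting

open CommutativeSemigroupProperties +-commutativeSemigroup using () renaming (interchange to +-interchange)

DownwardClosed : (ℕ → Bool) → Set
DownwardClosed P = ∀ i → P (suc i) ≡ true → P i ≡ true

downwardClosed-≤ : ∀ {P} → DownwardClosed P → ∀ {i j} → i ≤ j → P j ≡ true → P i ≡ true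
downwardClosed-≤ {P} dc = go ∘ ≤⇒≤′
  where
  go : ∀ {i j} → i ≤′ j → P j ≡ true → P i ≡ true
  go ≤′-refl         Pj = Pj
  go (≤′-step i≤′j) Pj = go i≤′j (dc _ Pj)

countBelow-cong : ∀ N {P Q} → (∀ i → i < N → P i ≡ Q i) → countBelow N P ≡ countBelow N Q
countBelow-cong zero    P≡Q = refl
countBelow-cong (suc N) P≡Q = cong₂ (λ c b → c + (if b then 1 else 0))
  (countBelow-cong N λ i i<N → P≡Q i (m≤n⇒m≤1+n i<N)) (P≡Q N ≤-refl)

countBelow-all : ∀ N {P} → (∀ i → i < N → P i ≡ true) → countBelow N P ≡ N
countBelow-all zero    P≡true = refl
countBelow-all (suc N) {P} P≡true rewrite P≡true N ≤-refl =
  trans (+-comm _ 1) (cong suc (countBelow-all N λ i i<N → P≡true i (m≤n⇒m≤1+n i<N)))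

countBelow-mono : ∀ N {P Q} → (∀ i → P i ≡ true → Q i ≡ true) → countBelow N P ≤ countBelow N Q
countBelow-mono zero    P⇒Q = z≤n
countBelow-mono (suc N) {P} {Q} P⇒Q with P N in PN | Q N in QN
... | true  | true  = +-monoˡ-≤ 1 (countBelow-mono N P⇒Q)
... | false | true  = +-mono-≤ (countBelow-mono N P⇒Q) z≤n
... | false | false = +-monoˡ-≤ 0 (countBelow-mono N P⇒Q)
... | true  | false = contradiction (trans (sym (P⇒Q N PN)) QN) λ ()

countBelow-split : ∀ N {P Q} → (∀ i → Q i ≡ true → P i ≡ true) →
  countBelow N (λ i → P i ∧ not (Q i)) + countBelow N Q ≡ countBelow N P
countBelow-split zero    Q⇒P = refl
countBelow-split (suc N) {P} {Q} Q⇒P =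
  trans (+-interchange (countBelow N (λ i → P i ∧ not (Q i))) _ (countBelow N Q) _)
        (cong₂ _+_ (countBelow-split N Q⇒P) (indicator-split (P N) (Q N) (Q⇒P N)))
  where
  indicator-split : ∀ p q → (q ≡ true → p ≡ true) →
    (if p ∧ not q then 1 else 0) + (if q then 1 else 0) ≡ (if p then 1 else 0)
  indicator-split true  true  _   = refl
  indicator-split true  false _   = refl
  indicator-split false false _   = refl
  indicator-split false true  q⇒p = contradiction (q⇒p refl) λ ()

countBelow-∧-not : ∀ N {P Q} → (∀ i → Q i ≡ true → P i ≡ true) →
  countBelow N (λ i → P i ∧ not (Q i)) ≡ countBelow N P ∸ countBelow N Q
countBelow-∧-not N {P} {Q} Q⇒P =
  trans (sym (m+n∸n≡m _ (countBelow N Q))) (cong (_∸ countBelow N Q) (countBelow-split N Q⇒P))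

countBelow-<ᵇ : ∀ N {d} → d ≤ N → countBelow N (_<ᵇ d) ≡ d
countBelow-<ᵇ zero    z≤n = refl
countBelow-<ᵇ (suc N) {d} d≤1+N with m≤n⇒m<n∨m≡n d≤1+N
... | inj₁ d<1+N rewrite ≥⇒<ᵇ≡false (≤-pred d<1+N) = trans (+-identityʳ _) (countBelow-<ᵇ N (≤-pred d<1+N))
... | inj₂ refl  rewrite <⇒<ᵇ≡true (n<1+n N) =
  trans (+-comm _ 1) (cong suc (countBelow-all N λ i i<N → <⇒<ᵇ≡true (m≤n⇒m≤1+n i<N)))

downwardClosed-prefix : ∀ N {P} → DownwardClosed P → (∀ i → P i ≡ true → i < N) →
  ∀ i → P i ≡ (i <ᵇ countBelow N P)
downwardClosed-prefix zero    dc P⇒< i =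
  true⇔<⇒≡<ᵇ {i = i} {d = 0} (λ ()) (λ Pi → contradiction (P⇒< i Pi) λ ())
downwardClosed-prefix (suc N) {P} dc P⇒< i with P N in PN
... | true  = true⇔<⇒≡<ᵇ (λ i<c → downwardClosed-≤ dc (≤-pred (subst (i <_) c≡1+N i<c)) PN)
                   (λ Pi → subst (i <_) (sym c≡1+N) (P⇒< i Pi))
  where
  c≡1+N : countBelow N P + 1 ≡ suc N
  c≡1+N = trans (+-comm _ 1) (cong suc (countBelow-all N λ j j<N → downwardClosed-≤ dc (<⇒≤ j<N) PN))
... | false = trans (downwardClosed-prefix N dc P⇒<N i) (cong (i <ᵇ_) (sym (+-identityʳ (countBelow N P))))
  where
  P⇒<N : ∀ j → P j ≡ true → j < N
  P⇒<N j Pj with m≤n⇒m<n∨m≡n (≤-pred (P⇒< j Pj))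
  ... | inj₁ j<N = j<N
  ... | inj₂ refl = contradiction (trans (sym Pj) PN) λ ()

-- Reading boxes of a tableau

nth-just⇒< : ∀ {A : Set} (xs : List A) j {x} → nth xs j ≡ just x → j < length xs
nth-just⇒< (y ∷ xs) zero    _ = s≤s z≤n
nth-just⇒< (y ∷ xs) (suc j) e = s≤s (nth-just⇒< xs j e)

nth-<⇒just : ∀ {A : Set} (xs : List A) j → j < length xs → ∃ λ x → nth xs j ≡ just x
nth-<⇒just (y ∷ xs) zero    _         = y , refl
nth-<⇒just (y ∷ xs) (suc j) (s≤s j<n) = nth-<⇒just xs j j<n

nth-≥⇒nothing : ∀ {A : Set} (xs : List A) j → length xs ≤ j → nth xs j ≡ nothing
nth-≥⇒nothing []       j       _         = refl
nth-≥⇒nothing (y ∷ xs) (suc j) (s≤s n≤j) = nth-≥⇒nothing xs j n≤j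

entry⇒<rowLen : ∀ T i j {x} → entry T i j ≡ just x → j < rowLen T i
entry⇒<rowLen T i j e with nth T i
... | just row = nth-just⇒< row j e
... | nothing with () ← e

<rowLen⇒entry : ∀ T i j → j < rowLen T i → ∃ λ x → entry T i j ≡ just x
<rowLen⇒entry T i j j<len with nth T i
... | just row = nth-<⇒just row j j<len

rowLen≤⇒noEntry : ∀ T i j → rowLen T i ≤ j → entry T i j ≡ nothing
rowLen≤⇒noEntry T i j len≤j with nth T i
... | just row = nth-≥⇒nothing row j len≤j
... | nothing  = refl

<rowLen⇒<length : ∀ T i j → j < rowLen T i → i < length T
<rowLen⇒<length T i j j<len with nth T i in row-i
... | just _ = nth-just⇒< T i row-i

inSub-true : ∀ T a i j {y} → entry T i j ≡ just y → y ≤ a → inSub T a i j ≡ true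
inSub-true T a i j e y≤a rewrite e = ≤⇒≤ᵇ≡true y≤a

inSub-true⇒ : ∀ T a i j → inSub T a i j ≡ true → ∃ λ y → entry T i j ≡ just y × y ≤ a
inSub-true⇒ T a i j e with entry T i j
... | just y = y , refl , ≤ᵇ≡true⇒≤ e

inSub-box : ∀ T a i j {y} → entry T i j ≡ just y → inSub T a i j ≡ (y ≤ᵇ a)
inSub-box T a i j e rewrite e = refl

inSub-noBox : ∀ T a i j → entry T i j ≡ nothing → inSub T a i j ≡ false
inSub-noBox T a i j e rewrite e = refl

augEntry-box : ∀ T r j {y} → entry T r j ≡ just y → augEntry T r j ≡ just (fin y)
augEntry-box T r j e with nth T r
... | just row with nth row j
...   | just y = cong (just ∘ fin) (just-injective e)

augEntry-rowEnd : ∀ T r → r < length T → augEntry T r (rowLen T r) ≡ just ∞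
augEntry-rowEnd T r r<len with nth T r | nth-<⇒just T r r<len
... | just row | _ rewrite nth-≥⇒nothing row (length row) ≤-refl
                         | Equivalence.to T-≡ (≡⇒≡ᵇ (length row) (length row) refl) = refl

inHead-box : ∀ T x k r {y} → entry T r (suc k) ≡ just y → inHead T x k r ≡ (x ≤ᵇ y)
inHead-box T x k r e rewrite augEntry-box T r (suc k) e = refl

inHead-rowEnd : ∀ T x k r → r < length T → suc k ≡ rowLen T r → inHead T x k r ≡ true
inHead-rowEnd T x k r r<len 1+k≡len rewrite 1+k≡len | augEntry-rowEnd T r r<len = refl

sameInHead-box : ∀ T x k r {y} → entry T r (suc k) ≡ just y → sameInHead T x k r ≡ ((x ≤ᵇ y) ∧ (x ≡ᵇ y))
sameInHead-box T x k r e rewrite augEntry-box T r (suc k) e = refl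

sameInHead-noBox : ∀ T x k r → entry T r (suc k) ≡ nothing → sameInHead T x k r ≡ false
sameInHead-noBox T x k r e with nth T r
... | nothing = refl
... | just row with nth row (suc k)
...   | nothing with suc k ≡ᵇ length row
...     | true  = refl
...     | false = refl

boxFactor : Tableau → ℕ → ℕ → Poly
boxFactor T i j = if noEqualInHead T i j then oneMinusT^ (headSize T i j) else oneᴾ

_≟ₘ_ : DecidableEquality (Maybe ℕ)
_≟ₘ_ = ≡-decₘ ℕ._≟_

letterBoxFactor : Tableau → ℕ → ℕ → ℕ → Poly
letterBoxFactor T a i j with entry T i j ≟ₘ just a
... | yes _ = boxFactor T i j
... | no  _ = oneᴾ

-- The factor of phiSkew T b at the column numbered k + 1, which Defs keeps local; phiSkew T b
-- reduces to prodBelow (rowLen T 0) (columnFactor T b).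
columnFactor : Tableau → ℕ → ℕ → Poly
columnFactor T b k =
  if θ′ (suc k) <ᵇ θ′ k then oneMinusT^ (colLen T (suc b) k ∸ colLen T (suc b) (suc k)) else oneᴾ
  where
  θ′ : ℕ → ℕ
  θ′ j = colLen T (suc b) j ∸ colLen T b j

boxFactor-noBox : ∀ T i j → entry T i j ≡ nothing → boxFactor T i j ≡ oneᴾ
boxFactor-noBox T i j e rewrite e = refl

boxFactor-box : ∀ T i j {x} → entry T i j ≡ just x →
  boxFactor T i j ≡ (if countBelow (suc i) (sameInHead T x j) ≡ᵇ 0
                      then oneMinusT^ (countBelow (suc i) (inHead T x j)) else oneᴾ)
boxFactor-box T i j e rewrite e = refl

letterBoxFactor-letter : ∀ T a i j → entry T i j ≡ just a → letterBoxFactor T a i j ≡ boxFactor T i j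
letterBoxFactor-letter T a i j e with entry T i j ≟ₘ just a
... | yes _ = refl
... | no ¬e = contradiction e ¬e

letterBoxFactor-other : ∀ T a i j → entry T i j ≢ just a → letterBoxFactor T a i j ≡ oneᴾ
letterBoxFactor-other T a i j ¬e with entry T i j ≟ₘ just a
... | yes e = contradiction e ¬e
... | no _  = refl

-- Semistandard tableaux

module Semistandard {n T} (S : SSYT n T) where
  open SSYT S

  rowLen-antitone : ∀ {i i′} → i ≤ i′ → rowLen T i′ ≤ rowLen T i
  rowLen-antitone = go ∘ ≤⇒≤′
    where
    go : ∀ {i i′} → i ≤′ i′ → rowLen T i′ ≤ rowLen T i
    go ≤′-refl         = ≤-refl
    go (≤′-step i≤′i′) = ≤-trans (partition _) (go i≤′i′)

  inSub-downwardClosed : ∀ a k → DownwardClosed (λ i → inSub T a i k)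
  inSub-downwardClosed a k i e with inSub-true⇒ T a (suc i) k e
  ... | y , e-y , y≤a with <rowLen⇒entry T i k (<-≤-trans (entry⇒<rowLen T (suc i) k e-y) (partition i))
  ...   | x , e-x = inSub-true T a i k e-x (≤-trans (<⇒≤ (colStrict i k x y e-x e-y)) y≤a)

  inSub⇒<length : ∀ a k i → inSub T a i k ≡ true → i < length T
  inSub⇒<length a k i e with inSub-true⇒ T a i k e
  ... | _ , e-y , _ = <rowLen⇒<length T i k (entry⇒<rowLen T i k e-y)

  inSub-prefix : ∀ a k i → inSub T a i k ≡ (i <ᵇ colLen T a k)
  inSub-prefix a k = downwardClosed-prefix (length T) (inSub-downwardClosed a k) (inSub⇒<length a k)

  <colLen⇒inSub : ∀ {a k i} → i < colLen T a k → inSub T a i k ≡ true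
  <colLen⇒inSub {a} {k} {i} i<c = trans (inSub-prefix a k i) (<⇒<ᵇ≡true i<c)

  inSub⇒<colLen : ∀ {a k i} → inSub T a i k ≡ true → i < colLen T a k
  inSub⇒<colLen {a} {k} {i} e = <ᵇ≡true⇒< (trans (sym (inSub-prefix a k i)) e)

  countBelow-inSub : ∀ {a k} N → colLen T a k ≤ N → countBelow N (λ r → inSub T a r k) ≡ colLen T a k
  countBelow-inSub {a} {k} N c≤N = trans (countBelow-cong N λ r _ → inSub-prefix a k r) (countBelow-<ᵇ N c≤N)

  colLen-antitone : ∀ a k → colLen T a (suc k) ≤ colLen T a k
  colLen-antitone a k = countBelow-mono (length T) weakRow
    where
    weakRow : ∀ i → inSub T a i (suc k) ≡ true → inSub T a i k ≡ true
    weakRow i e with inSub-true⇒ T a i (suc k) e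
    ... | y , e-y , y≤a with <rowLen⇒entry T i k (<-trans (n<1+n k) (entry⇒<rowLen T i (suc k) e-y))
    ...   | x , e-x = inSub-true T a i k e-x (≤-trans (rowWeak i k x y e-x e-y) y≤a)

  inSub-monotone : ∀ {a a′} → a ≤ a′ → ∀ i k → inSub T a i k ≡ true → inSub T a′ i k ≡ true
  inSub-monotone a≤a′ i k e with inSub-true⇒ T _ i k e
  ... | y , e-y , y≤a = inSub-true T _ i k e-y (≤-trans y≤a a≤a′)

  colLen-monotone : ∀ {a a′} → a ≤ a′ → ∀ k → colLen T a k ≤ colLen T a′ k
  colLen-monotone a≤a′ k = countBelow-mono (length T) λ i → inSub-monotone a≤a′ i k

  letter⇒between : ∀ {b i k} → entry T i k ≡ just (suc b) → colLen T b k ≤ i × i < colLen T (suc b) k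
  letter⇒between {b} {i} {k} e =
    ≮⇒≥ (λ i<c → <⇒≱ ≤-refl (letter≤b (inSub-true⇒ T b i k (<colLen⇒inSub i<c)))) ,
    inSub⇒<colLen (inSub-true T (suc b) i k e ≤-refl)
    where
    letter≤b : (∃ λ y → entry T i k ≡ just y × y ≤ b) → suc b ≤ b
    letter≤b (y , e-y , y≤b) = subst (_≤ b) (just-injective (trans (sym e-y) e)) y≤b

  between⇒letter : ∀ {b i k} → colLen T b k ≤ i → i < colLen T (suc b) k → entry T i k ≡ just (suc b)
  between⇒letter {b} {i} {k} c≤i i<d with inSub-true⇒ T (suc b) i k (<colLen⇒inSub i<d)
  ... | y , e-y , y≤1+b = subst (λ z → entry T i k ≡ just z) (≤-antisym y≤1+b (≰⇒> y≰b)) e-y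
    where
    y≰b : ¬ y ≤ b
    y≰b y≤b = <⇒≱ (inSub⇒<colLen (inSub-true T b i k e-y y≤b)) c≤i

  letterOncePerColumn : ∀ b k → colLen T (suc b) k ≤ suc (colLen T b k)
  letterOncePerColumn b k = ≮⇒≥ λ 1+c<d →
    <-irrefl refl (colStrict c k (suc b) (suc b)
      (between⇒letter ≤-refl (<-trans (n<1+n c) 1+c<d)) (between⇒letter (n≤1+n c) 1+c<d))
    where c = colLen T b k

  letter⇒colLen : ∀ {b i k} → entry T i k ≡ just (suc b) → colLen T b k ≡ i × colLen T (suc b) k ≡ suc i
  letter⇒colLen {b} {i} {k} e with letter⇒between e
  ... | c≤i , i<d = c≡i , ≤-antisym (subst (λ c → colLen T (suc b) k ≤ suc c) c≡i (letterOncePerColumn b k))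
                                    i<d
    where
    c≡i : colLen T b k ≡ i
    c≡i = ≤-antisym c≤i (≤-pred (≤-trans i<d (letterOncePerColumn b k)))

  inHead-letter : ∀ b k r → suc k ≤ rowLen T r → inHead T (suc b) k r ≡ not (inSub T b r (suc k))
  inHead-letter b k r 1+k≤len with m≤n⇒m<n∨m≡n 1+k≤len
  ... | inj₁ 1+k<len with <rowLen⇒entry T r (suc k) 1+k<len
  ...   | y , e-y = begin
    inHead T (suc b) k r        ≡⟨ inHead-box T (suc b) k r e-y ⟩
    suc b ≤ᵇ y                  ≡⟨ 1+b≤ᵇ≡not≤ᵇ b y ⟩
    not (y ≤ᵇ b)                ≡⟨ cong not (inSub-box T b r (suc k) e-y) ⟨
    not (inSub T b r (suc k))   ∎
    where open ≡-Reasoning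
  inHead-letter b k r 1+k≤len | inj₂ 1+k≡len =
    trans (inHead-rowEnd T (suc b) k r (<rowLen⇒<length T r k 1+k≤len) 1+k≡len)
          (cong not (sym (inSub-noBox T b r (suc k)
                           (rowLen≤⇒noEntry T r (suc k) (≤-reflexive (sym 1+k≡len))))))

  sameInHead-letter : ∀ b k r →
    sameInHead T (suc b) k r ≡ (inSub T (suc b) r (suc k) ∧ not (inSub T b r (suc k)))
  sameInHead-letter b k r with entry T r (suc k) in e
  ... | just y  = trans (sameInHead-box T (suc b) k r e) (1+b≤ᵇ∧≡ᵇ≡≤ᵇ∧not≤ᵇ b y)
  ... | nothing = sameInHead-noBox T (suc b) k r e

  headCount-letter : ∀ {b i k} → entry T i k ≡ just (suc b) →
    countBelow (suc i) (inHead T (suc b) k) ≡ suc i ∸ colLen T b (suc k)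
  headCount-letter {b} {i} {k} e = begin
    countBelow (suc i) (inHead T (suc b) k)
      ≡⟨ countBelow-cong (suc i) (λ r r≤i → inHead-letter b k r (columnInRow r (≤-pred r≤i))) ⟩
    countBelow (suc i) (λ r → true ∧ not (inSub T b r (suc k)))
      ≡⟨ countBelow-∧-not (suc i) (λ _ _ → refl) ⟩
    countBelow (suc i) (λ _ → true) ∸ countBelow (suc i) (λ r → inSub T b r (suc k))
      ≡⟨ cong₂ _∸_ (countBelow-all (suc i) λ _ _ → refl) (countBelow-inSub (suc i) c≤1+i) ⟩
    suc i ∸ colLen T b (suc k) ∎
    where
    open ≡-Reasoning
    columnInRow : ∀ r → r ≤ i → suc k ≤ rowLen T r
    columnInRow r r≤i = ≤-trans (entry⇒<rowLen T i k e) (rowLen-antitone r≤i)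
    c≤1+i : colLen T b (suc k) ≤ suc i
    c≤1+i = ≤-trans (colLen-antitone b k) (m≤n⇒m≤1+n (proj₁ (letter⇒between e)))

  equalInHeadCount-letter : ∀ {b i k} → entry T i k ≡ just (suc b) →
    countBelow (suc i) (sameInHead T (suc b) k) ≡ colLen T (suc b) (suc k) ∸ colLen T b (suc k)
  equalInHeadCount-letter {b} {i} {k} e = begin
    countBelow (suc i) (sameInHead T (suc b) k)
      ≡⟨ countBelow-cong (suc i) (λ r _ → sameInHead-letter b k r) ⟩
    countBelow (suc i) (λ r → inSub T (suc b) r (suc k) ∧ not (inSub T b r (suc k)))
      ≡⟨ countBelow-∧-not (suc i) (λ r → inSub-monotone (n≤1+n b) r (suc k)) ⟩
    countBelow (suc i) (λ r → inSub T (suc b) r (suc k)) ∸ countBelow (suc i) (λ r → inSub T b r (suc k))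
      ≡⟨ cong₂ _∸_ (countBelow-inSub (suc i) d≤1+i) (countBelow-inSub (suc i) c≤1+i) ⟩
    colLen T (suc b) (suc k) ∸ colLen T b (suc k) ∎
    where
    open ≡-Reasoning
    d≤1+i : colLen T (suc b) (suc k) ≤ suc i
    d≤1+i = ≤-trans (colLen-antitone (suc b) k) (≤-reflexive (proj₂ (letter⇒colLen e)))
    c≤1+i : colLen T b (suc k) ≤ suc i
    c≤1+i = ≤-trans (colLen-monotone (n≤1+n b) (suc k)) d≤1+i

  columnFactor≡boxFactor : ∀ {b i k} → entry T i k ≡ just (suc b) → columnFactor T b k ≡ boxFactor T i k
  columnFactor≡boxFactor {b} {i} {k} e = begin
    columnFactor T b k
      ≡⟨ cong₂ (λ θ m → if d ∸ c <ᵇ θ then oneMinusT^ (m ∸ d) else oneᴾ) θ≡1 (proj₂ (letter⇒colLen e)) ⟩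
    (if d ∸ c <ᵇ 1 then oneMinusT^ (suc i ∸ d) else oneᴾ)
      ≡⟨ exponents-agree (colLen-monotone (n≤1+n b) (suc k)) ⟩
    (if d ∸ c ≡ᵇ 0 then oneMinusT^ (suc i ∸ c) else oneᴾ)
      ≡⟨ cong₂ (λ m h → if m ≡ᵇ 0 then oneMinusT^ h else oneᴾ)
               (equalInHeadCount-letter e) (headCount-letter e) ⟨
    (if countBelow (suc i) (sameInHead T (suc b) k) ≡ᵇ 0
      then oneMinusT^ (countBelow (suc i) (inHead T (suc b) k)) else oneᴾ)
      ≡⟨ boxFactor-box T i k e ⟨
    boxFactor T i k ∎
    where
    open ≡-Reasoning
    c = colLen T b (suc k)
    d = colLen T (suc b) (suc k)
    θ≡1 : colLen T (suc b) k ∸ colLen T b k ≡ 1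
    θ≡1 rewrite proj₁ (letter⇒colLen e) | proj₂ (letter⇒colLen e) = m+n∸n≡m 1 i
    exponents-agree : c ≤ d → (if d ∸ c <ᵇ 1 then oneMinusT^ (suc i ∸ d) else oneᴾ)
                            ≡ (if d ∸ c ≡ᵇ 0 then oneMinusT^ (suc i ∸ c) else oneᴾ)
    exponents-agree c≤d with d ∸ c in d∸c≡θ
    ... | zero  rewrite ≤-antisym c≤d (m∸n≡0⇒m≤n d∸c≡θ) = refl
    ... | suc _ = refl

  columnFactor≋letterBoxFactors : ∀ b k →
    columnFactor T b k ≋ prodBelow (length T) (λ i → letterBoxFactor T (suc b) i k)
  columnFactor≋letterBoxFactors b k with colLen T b k <? colLen T (suc b) k
  ... | yes c<d = ≋-sym (≋-trans (prodBelow-single (length T) c c<len others)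
                                 (≡⇒≋ (trans (letterBoxFactor-letter T (suc b) c k e)
                                             (sym (columnFactor≡boxFactor e)))))
    where
    c = colLen T b k
    e : entry T c k ≡ just (suc b)
    e = between⇒letter ≤-refl c<d
    c<len : c < length T
    c<len = <rowLen⇒<length T c k (entry⇒<rowLen T c k e)
    others : ∀ i → i < length T → i ≢ c → letterBoxFactor T (suc b) i k ≋ oneᴾ
    others i _ i≢c = ≡⇒≋ (letterBoxFactor-other T (suc b) i k λ e′ → i≢c (sym (proj₁ (letter⇒colLen e′))))
  ... | no c≮d = ≋-trans (≡⇒≋ noLetter) (≋-sym (prodBelow-oneᴾ (length T) λ i _ →
                   ≡⇒≋ (letterBoxFactor-other T (suc b) i k (c≮d ∘ uncurry ≤-<-trans ∘ letter⇒between))))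
    where
    noLetter : columnFactor T b k ≡ oneᴾ
    noLetter rewrite m≤n⇒m∸n≡0 (≮⇒≥ c≮d) = refl

  letterBoxFactors≋boxFactor : ∀ i k →
    prodBelow (suc n) (λ b → letterBoxFactor T (suc b) i k) ≋ boxFactor T i k
  letterBoxFactors≋boxFactor i k with k <? rowLen T i
  ... | no k≮len = ≋-trans (prodBelow-oneᴾ (suc n) λ b _ →
                             ≡⇒≋ (letterBoxFactor-other T (suc b) i k (k≮len ∘ entry⇒<rowLen T i k)))
                           (≡⇒≋ (sym (boxFactor-noBox T i k (rowLen≤⇒noEntry T i k (≮⇒≥ k≮len)))))
  ... | yes k<len with <rowLen⇒entry T i k k<len
  ...   | zero , e = contradiction (proj₁ (alphabet i k zero e)) λ ()
  ...   | suc b₀ , e = ≋-trans (prodBelow-single (suc n) b₀ (proj₂ (alphabet i k (suc b₀) e)) others)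
                               (≡⇒≋ (letterBoxFactor-letter T (suc b₀) i k e))
    where
    others : ∀ b → b < suc n → b ≢ b₀ → letterBoxFactor T (suc b) i k ≋ oneᴾ
    others b _ b≢b₀ = ≡⇒≋ (letterBoxFactor-other T (suc b) i k λ e′ →
      b≢b₀ (suc-injective (just-injective (trans (sym e′) e))))

theorem34 : (n : ℕ) → 1 ≤ n → (T : Tableau) → SSYT n T →
    phiT n T ≈ᴾ headProduct T
theorem34 n _ T S = coeff-≡ (begin
  phiT n T
    ≡⟨⟩
  prodBelow (suc n) (λ b → prodBelow L (columnFactor T b))
    ≈⟨ prodBelow-cong (suc n) (λ b _ → prodBelow-cong L λ k _ → columnFactor≋letterBoxFactors b k) ⟩
  prodBelow (suc n) (λ b → prodBelow L (λ k → prodBelow H (λ i → letterBoxFactor T (suc b) i k)))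
    ≈⟨ prodBelow-reverse₃ (suc n) L H _ ⟩
  prodBelow H (λ i → prodBelow L (λ k → prodBelow (suc n) (λ b → letterBoxFactor T (suc b) i k)))
    ≈⟨ prodBelow-cong H (λ i _ → prodBelow-cong L λ k _ → letterBoxFactors≋boxFactor i k) ⟩
  prodBelow H (λ i → prodBelow L (boxFactor T i))
    ≈⟨ prodBelow-cong H (λ i _ → prodBelow-truncate L (rowLen-antitone z≤n) λ j len≤j _ →
         ≡⇒≋ (boxFactor-noBox T i j (rowLen≤⇒noEntry T i j len≤j))) ⟩
  headProduct T ∎)
  where
  open Semistandard S
  open SetoidReasoning ≋-setoid
  H : ℕ
  H = length T
  L : ℕ
  L = rowLen T 0
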